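{- In any Q-structure, for any facts $F,G$: $1\in F\multimap G$ iff $F\subseteq G$.
   Context: A Q-structure is a tuple $\langle\mathcal P,\mathcal Z,\cdot,1\rangle$ with $\mathcal P$ a set, $\mathcal Z\subseteq\mathcal P$, $\cdot$ a binary operation on $\mathcal P$ (not assumed associative or commutative), and $1\in\mathcal P$. These satisfy, for all $x,y,z$: $x\cdot y\in\mathcal Z$ iff $y\cdot x\in\mathcal Z$; $(x\cdot y)\cdot z\in\mathcal Z$ iff $x\cdot(z\cdot y)\in\mathcal Z$; and $1\cdot x=x\cdot1=x$. For $A\subseteq\mathcal P$, $A^\perp=\{b: b\cdot a\in\mathcal Z\ \forall a\in A\}$. A fact is a subset $F$ with $F=(F^\perp)^\perp$. For $A,B\subseteq\mathcal P$, $A\cdot B=\{a\cdot b:a\in A,b\in B\}$. Linear implication on facts: $F\multimap G=(F\cdot G^\perp)^\perp$. (A fact $F$ is called valid when $1\in F$.) -}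

module Defs where

open import Level using (Level; _⊔_; suc)
open import Data.Product using (Σ; _×_; _,_; ∃-syntax)
open import Relation.Binary.PropositionalEquality using (_≡_)
open import Relation.Unary using (Pred; _⊆_; _∈_)

record QStructure (ℓ : Level) : Set (suc ℓ) where
  infixl 7 _·_
  field
    Carrier : Set ℓ
    Z       : Pred Carrier ℓ
    _·_     : Carrier → Carrier → Carrier
    one     : Carrier
    comm-Z₁ : ∀ x y → Z (x · y) → Z (y · x)
    comm-Z₂ : ∀ x y → Z (y · x) → Z (x · y)
    shift₁  : ∀ x y z → Z ((x · y) · z) → Z (x · (z · y))
    shift₂  : ∀ x y z → Z (x · (z · y)) → Z ((x · y) · z)
    unitˡ   : ∀ x → one · x ≡ x
    unitʳ   : ∀ x → x · one ≡ x

module QOps {ℓ : Level} (Q : QStructure ℓ) where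
  open QStructure Q

  _⊥ : Pred Carrier ℓ → Pred Carrier ℓ
  (A ⊥) b = ∀ a → a ∈ A → Z (b · a)

  _⊙_ : Pred Carrier ℓ → Pred Carrier ℓ → Pred Carrier ℓ
  (A ⊙ B) c = ∃[ a ] ∃[ b ] (a ∈ A × b ∈ B × c ≡ a · b)

  IsFact : Pred Carrier ℓ → Set ℓ
  IsFact F = (F ⊆ ((F ⊥) ⊥)) × (((F ⊥) ⊥) ⊆ F)

  _⊸_ : Pred Carrier ℓ → Pred Carrier ℓ → Pred Carrier ℓ
  F ⊸ G = (F ⊙ (G ⊥)) ⊥

{-# OPTIONS --safe #-}
module Submission where

open import Defs
open import Level using (Level)
open import Relation.Unary using (Pred; _⊆_; _∈_)
open import Function.Bundles using (_⇔_; mk⇔)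
open import Function.Construct.Composition using (_⇔-∘_)
open import Data.Product using (_,_)
open import Relation.Binary.PropositionalEquality using (refl; subst; sym)

-- 1 ∈ F ⊸ G says exactly that F · G^⊥ ⊆ Z, and by the symmetry of Z that is F ⊆ G^⊥⊥ = G.

module _ {ℓ : Level} (Q : QStructure ℓ) where
  open QStructure Q
  open QOps Q

  one∈⊥⇔⊆Z : (A : Pred Carrier ℓ) → one ∈ (A ⊥) ⇔ A ⊆ Z
  one∈⊥⇔⊆Z A = mk⇔
    (λ h {a} a∈A → subst Z (unitˡ a) (h a a∈A))
    (λ A⊆Z a a∈A → subst Z (sym (unitˡ a)) (A⊆Z a∈A))

  ⊙⊆Z⇔⊆⊥ : (A B : Pred Carrier ℓ) → (A ⊙ B) ⊆ Z ⇔ A ⊆ (B ⊥)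
  ⊙⊆Z⇔⊆⊥ A B = mk⇔
    (λ h {a} a∈A b b∈B → h (a , b , a∈A , b∈B , refl))
    (λ { A⊆B⊥ {_} (a , b , a∈A , b∈B , refl) → A⊆B⊥ a∈A b b∈B })

  ⊆⊥⊥ : (A : Pred Carrier ℓ) → A ⊆ ((A ⊥) ⊥)
  ⊆⊥⊥ A {a} a∈A b b∈A⊥ = comm-Z₁ b a (b∈A⊥ a a∈A)

  ⊆⊥⊥⇔⊆ : (F : Pred Carrier ℓ) {G : Pred Carrier ℓ} → ((G ⊥) ⊥) ⊆ G → F ⊆ ((G ⊥) ⊥) ⇔ F ⊆ G
  ⊆⊥⊥⇔⊆ F {G} G⊥⊥⊆G = mk⇔
    (λ F⊆G⊥⊥ {_} f∈F → G⊥⊥⊆G (F⊆G⊥⊥ f∈F))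
    (λ F⊆G {_} f∈F → ⊆⊥⊥ G (F⊆G f∈F))

-- F need not be a fact; of G only G^⊥⊥ ⊆ G is used.
lemma10 : {ℓ : Level} (Q : QStructure ℓ) (F G : Pred (QStructure.Carrier Q) ℓ) → QOps.IsFact Q F → QOps.IsFact Q G → (QStructure.one Q ∈ QOps._⊸_ Q F G) ⇔ (F ⊆ G)
lemma10 Q F G _ (_ , G⊥⊥⊆G) =
  ⊆⊥⊥⇔⊆ Q F G⊥⊥⊆G ⇔-∘ (⊙⊆Z⇔⊆⊥ Q F (G ⊥) ⇔-∘ one∈⊥⇔⊆Z Q (F ⊙ (G ⊥)))
  where open QOps Q
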